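{- Let $Q\ge3$ and $r\ge2$. Let $\mathscr D_Q^{(r)}$ be the set of pairs $(q_1,q_{r+1})$ such that there are consecutive elements $a_1/q_1<a_2/q_2<\cdots<a_{r+1}/q_{r+1}$ of $\mathcal F_Q$ (in lowest terms) with $a_1/q_1,\ a_{r+1}/q_{r+1}\in\mathfrak{SF}_Q$ and $a_2/q_2,\ldots,a_r/q_r\notin\mathfrak{SF}_Q$. Then $\mathscr D_Q^{(r)}\subseteq Q\mathcal V_2\cup Q\mathcal V_3$, where $\mathcal V_2:=\{(x,y)\in[0,1/2]\times[1/5,1]:\max\{(1-3x)/2,x\}\le y\le1-x\}$ and $\mathcal V_3:=\{(x,y)\in[1/5,2/3]\times[0,1/2]:\max\{(1-3x)/2,0,2x-1\}\le y\le\min\{x,1-x\}\}$.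
   Context: $\mathcal F_Q:=\{d/b: 1\le d\le b\le Q,\ \gcd(d,b)=1\}$. For a reduced fraction $a/q\in(0,1]$ with $q\ge2$, $\bar a$ is the inverse of $a$ modulo $q$ in $[1,q)$ and $h(a/q):=q+a+\bar a$; $h(1/1):=3$; $\mathfrak{SF}_Q:=\{a/q\in\mathbb Q\cap(0,1]:h(a/q)\le Q\}$. Consecutive means adjacent in increasing order. $Q\mathcal V_i=\{(Qx,Qy):(x,y)\in\mathcal V_i\}$. -}

module Defs where

open import Data.Nat using (ℕ; zero; suc; _+_; _*_; _≤_; _<_)
open import Data.Nat.Coprimality using (Coprime)
open import Data.Fin using (Fin; toℕ; inject₁; fromℕ) renaming (suc to fsuc; zero to fzero)
open import Data.Product using (Σ; ∃; _×_; _,_)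
open import Data.Sum using (_⊎_)
open import Relation.Nullary using (¬_)
open import Relation.Binary.PropositionalEquality using (_≡_)

InFarey : ℕ → ℕ → ℕ → Set
InFarey Q a q = 1 ≤ a × a ≤ q × q ≤ Q × Coprime a q

-- a/q < b/s  (positive denominators)
FracLt : ℕ → ℕ → ℕ → ℕ → Set
FracLt a q b s = a * s < b * q

ConsecutiveIn : ℕ → ℕ → ℕ → ℕ → ℕ → Set
ConsecutiveIn Q a q b s =
  InFarey Q a q × InFarey Q b s × FracLt a q b s ×
  (∀ c t → InFarey Q c t → ¬ (FracLt a q c t × FracLt c t b s))

HeightIs : ℕ → ℕ → ℕ → Set
HeightIs a q n =
  (a ≡ 1 × q ≡ 1 × n ≡ 3)
  ⊎ (2 ≤ q × Σ ℕ λ ā → 1 ≤ ā × ā < q × (Σ ℕ λ k → a * ā ≡ 1 + k * q) × n ≡ q + a + ā)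

InSF : ℕ → ℕ → ℕ → Set
InSF Q a q = Σ ℕ λ n → HeightIs a q n × n ≤ Q

-- (x , y) ∈ 𝒟_Q^{(r)}: there are consecutive a₀/q₀ < … < a_r/q_r in 𝓕_Q
-- (indices 0..r, i.e. the paper's 1..r+1) with the endpoints in 𝔖𝔉_Q and all
-- interior ones not in 𝔖𝔉_Q, and q₀ = x, q_r = y.
InD : ℕ → ℕ → ℕ → ℕ → Set
InD Q r x y =
  Σ (Fin (suc r) → ℕ) λ a → Σ (Fin (suc r) → ℕ) λ q →
    (∀ (i : Fin r) → ConsecutiveIn Q (a (inject₁ i)) (q (inject₁ i)) (a (fsuc i)) (q (fsuc i)))
    × InSF Q (a fzero) (q fzero)
    × InSF Q (a (fromℕ r)) (q (fromℕ r))
    × (∀ (i : Fin (suc r)) → 0 < toℕ i → toℕ i < r → ¬ InSF Q (a i) (q i))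
    × q fzero ≡ x × q (fromℕ r) ≡ y

-- (x , y) ∈ Q𝒱₂, i.e. (x/Q , y/Q) ∈ 𝒱₂, with all inequalities multiplied by
-- positive constants to clear denominators (x, y ≥ 0 are automatic in ℕ):
--   x/Q ≤ 1/2, 1/5 ≤ y/Q ≤ 1, (1 - 3x/Q)/2 ≤ y/Q, x/Q ≤ y/Q, y/Q ≤ 1 - x/Q.
InQV2 : ℕ → ℕ → ℕ → Set
InQV2 Q x y =
  2 * x ≤ Q × Q ≤ 5 * y × y ≤ Q × Q ≤ 3 * x + 2 * y × x ≤ y × x + y ≤ Q

-- (x , y) ∈ Q𝒱₃:
--   1/5 ≤ x/Q ≤ 2/3, y/Q ≤ 1/2, (1 - 3x/Q)/2 ≤ y/Q, 2x/Q - 1 ≤ y/Q,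
--   y/Q ≤ x/Q, y/Q ≤ 1 - x/Q.
InQV3 : ℕ → ℕ → ℕ → Set
InQV3 Q x y =
  Q ≤ 5 * x × 3 * x ≤ 2 * Q × 2 * y ≤ Q × Q ≤ 3 * x + 2 * y ×
  2 * x ≤ Q + y × y ≤ x × x + y ≤ Q

{-# OPTIONS --safe #-}
-- Let A/X < B/Y be the endpoints of the chain. Every fraction of 𝓕_Q strictly between them
-- is an interior element, so none of them lies in 𝔖𝔉_Q. Hence BX − AY = 1: otherwise the
-- Stern–Brocot parent of the endpoint with the larger denominator (the right parent of A/X
-- if Y ≤ X, the left parent of B/Y if X < Y) has height at most that endpoint's and would
-- lie strictly between them, because a fraction strictly between two Farey neighbours has
-- denominator at least the sum of theirs. For the same reason the interior element a₁/q₁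
-- (r ≥ 2) gives X + Y ≤ q₁ ≤ Q, so the mediant (A+B)/(X+Y) lies in 𝓕_Q but not in 𝔖𝔉_Q,
-- i.e. Q < h((A+B)/(X+Y)) = 2X + Y + A + B ≤ 3X + 2Y. If Y < X, the inverse of A modulo X
-- is X − Y, so h(A/X) = 2X + A − Y ≤ Q. These three inequalities cut out Q𝒱₂ ∪ Q𝒱₃.
module Submission where

open import Defs
open import Data.Nat
  using (ℕ; zero; suc; _+_; _*_; _⊓_; _≤_; _<_; _≤?_; z≤n; s≤s; z<s; s<s; NonZero; >-nonZero)
open import Data.Nat.Properties
open import Data.Nat.DivMod
  using (_%_; _/_; m≡m%n+[m/n]*n; m%n<n; m%n≤m; m%n≤n; [m+kn]%n≡m%n; m<n⇒m%n≡m; %-congˡ)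
open import Data.Nat.Divisibility
  using (_∣_; divides; ∣-antisym; ∣1⇒≡1; ∣m+n∣m⇒∣n; n∣m*n; ∣m⇒∣m*n; ∣n⇒∣m*n)
open import Data.Nat.Coprimality using (Coprime; coprime-divisor) renaming (sym to coprime-sym)
open import Data.Nat.Tactic.RingSolver using (solve-∀)
open import Data.Fin using (Fin; toℕ; inject₁; fromℕ) renaming (zero to fzero; suc to fsuc)
open import Data.Product using (∃; ∃₂; _×_; _,_; proj₁; proj₂)
open import Data.Sum using (_⊎_; inj₁; inj₂)
open import Data.Empty using (⊥-elim)
open import Function using (_∘_)
open import Relation.Nullary using (¬_; yes; no)
open import Relation.Binary.PropositionalEquality
  using (_≡_; refl; sym; trans; cong; subst; module ≡-Reasoning)
open import Relation.Binary.Definitions using (tri<; tri≈; tri>)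

m*n≡1+k⇒0<n : ∀ m {n k} → m * n ≡ suc k → 0 < n
m*n≡1+k⇒0<n m {zero}  eq = ⊥-elim (0≢1+n (trans (sym (*-zeroʳ m)) eq))
m*n≡1+k⇒0<n m {suc n} _  = z<s

det≡1⇒coprime : ∀ a b c d → a * b ≡ 1 + c * d → Coprime a d
det≡1⇒coprime a b c d eq {i} (i∣a , i∣d) =
  ∣1⇒≡1 (∣m+n∣m⇒∣n (subst (i ∣_) (trans eq (+-comm 1 (c * d))) (∣m⇒∣m*n b i∣a))
                    (∣n⇒∣m*n c i∣d))

coprime-cross⇒≡ : ∀ {a q c t} .{{_ : NonZero t}} → Coprime a q → Coprime c t →
                  a * t ≡ c * q → a ≡ c × q ≡ t
coprime-cross⇒≡ {a} {q} {c} {t} a⊥q c⊥t at≡cq =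
  *-cancelʳ-≡ a c t (trans at≡cq (cong (c *_) q≡t)) , q≡t
  where
  q≡t : q ≡ t
  q≡t = ∣-antisym (coprime-divisor (coprime-sym a⊥q) (subst (q ∣_) (sym at≡cq) (n∣m*n c)))
                  (coprime-divisor (coprime-sym c⊥t) (subst (t ∣_) at≡cq (n∣m*n a)))

denominator>0 : ∀ {Q a q} → InFarey Q a q → 0 < q
denominator>0 (1≤a , a≤q , _) = ≤-trans 1≤a a≤q

FracLt-trichotomy : ∀ {Q a q c t} → InFarey Q a q → InFarey Q c t →
                    FracLt a q c t ⊎ (a ≡ c × q ≡ t) ⊎ FracLt c t a q
FracLt-trichotomy {a = a} {q} {c} {t} (_ , _ , _ , a⊥q) F@(_ , _ , _ , c⊥t)
  with <-cmp (a * t) (c * q)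
... | tri< lt _ _ = inj₁ lt
... | tri≈ _ eq _ = inj₂ (inj₁ (coprime-cross⇒≡ {{>-nonZero (denominator>0 F)}} a⊥q c⊥t eq))
... | tri> _ _ gt = inj₂ (inj₂ gt)

FracLt-trans : ∀ a q b s c t → 0 < q → 0 < t →
               FracLt a q b s → FracLt b s c t → FracLt a q c t
FracLt-trans a q@(suc _) b s c t@(suc _) _ _ as<bq bt<cs =
  *-cancelʳ-< s (a * t) (c * q) (begin-strict
    a * t * s  ≡⟨ swap a t s ⟩
    a * s * t  <⟨ *-monoˡ-< t as<bq ⟩
    b * q * t  ≡⟨ swap b q t ⟩
    b * t * q  <⟨ *-monoˡ-< q bt<cs ⟩
    c * s * q  ≡⟨ swap c s q ⟩
    c * q * s  ∎)
  where
  open ≤-Reasoning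
  swap : ∀ x y z → x * y * z ≡ x * z * y
  swap = solve-∀

neighbours-squeeze : ∀ a q x y b s → b * q ≡ 1 + a * s →
                     FracLt a q x y → FracLt x y b s → q + s ≤ y
neighbours-squeeze a q x y b s bq≡1+as ay<xq xs<by
  with α , 1+ay+α≡xq ← m≤n⇒∃[o]m+o≡n ay<xq
     | β , 1+xs+β≡by ← m≤n⇒∃[o]m+o≡n xs<by
  = subst (q + s ≤_) (sym y≡) (m≤m+n (q + s) (q * β + s * α))
  where
  open ≡-Reasoning
  y≡ : y ≡ q + s + (q * β + s * α)
  y≡ = +-cancelʳ-≡ (a * s * y) y _ (begin
    (1 + a * s) * y                      ≡⟨ cong (_* y) bq≡1+as ⟨
    b * q * y                            ≡⟨ e₁ b q y ⟩
    q * (b * y)                          ≡⟨ cong (q *_) 1+xs+β≡by ⟨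
    q * (1 + x * s + β)                  ≡⟨ e₂ q x s β ⟩
    q + q * β + s * (x * q)              ≡⟨ cong (λ z → q + q * β + s * z) 1+ay+α≡xq ⟨
    q + q * β + s * (1 + a * y + α)      ≡⟨ e₃ q β s a y α ⟩
    q + s + (q * β + s * α) + a * s * y  ∎)
    where
    e₁ : ∀ b q y → b * q * y ≡ q * (b * y)
    e₁ = solve-∀
    e₂ : ∀ q x s β → q * (1 + x * s + β) ≡ q + q * β + s * (x * q)
    e₂ = solve-∀
    e₃ : ∀ q β s a y α →
         q + q * β + s * (1 + a * y + α) ≡ q + s + (q * β + s * α) + a * s * y
    e₃ = solve-∀

mediant-neighbours : ∀ a q b s → b * q ≡ 1 + a * s →
                     (a + b) * q ≡ 1 + a * (q + s) × b * (q + s) ≡ 1 + (a + b) * s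
mediant-neighbours a q b s bq≡1+as = left , right
  where
  open ≡-Reasoning
  left : (a + b) * q ≡ 1 + a * (q + s)
  left = begin
    (a + b) * q          ≡⟨ *-distribʳ-+ q a b ⟩
    a * q + b * q        ≡⟨ cong (a * q +_) bq≡1+as ⟩
    a * q + (1 + a * s)  ≡⟨ e a q s ⟩
    1 + a * (q + s)      ∎
    where
    e : ∀ a q s → a * q + (1 + a * s) ≡ 1 + a * (q + s)
    e = solve-∀
  right : b * (q + s) ≡ 1 + (a + b) * s
  right = begin
    b * (q + s)          ≡⟨ *-distribˡ-+ b q s ⟩
    b * q + b * s        ≡⟨ cong (_+ b * s) bq≡1+as ⟩
    1 + a * s + b * s    ≡⟨ cong suc (*-distribʳ-+ s a b) ⟨
    1 + (a + b) * s      ∎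

right-neighbour-≤1 : ∀ {a q b s} → b * q ≡ 1 + a * s → a < q → 0 < s → b ≤ s
right-neighbour-≤1 {a} {q} {b} {s} bq≡1+as a<q 0<s =
  *-cancelʳ-≤ b s q {{>-nonZero (m<n⇒0<n a<q)}} (begin
    b * q      ≡⟨ bq≡1+as ⟩
    1 + a * s  ≤⟨ +-monoˡ-≤ (a * s) 0<s ⟩
    suc a * s  ≤⟨ *-monoˡ-≤ s a<q ⟩
    q * s      ≡⟨ *-comm q s ⟩
    s * q      ∎)
  where open ≤-Reasoning

%-inverse : ∀ {a y z n} .{{_ : NonZero n}} → 1 < n → a * y ≡ 1 + z * n →
            ∃ λ k → a * (y % n) ≡ 1 + k * n
%-inverse {a} {y} {z} {n} 1<n ay≡1+zn = a * (y % n) / n , (begin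
    a * (y % n)                            ≡⟨ m≡m%n+[m/n]*n (a * (y % n)) n ⟩
    a * (y % n) % n + a * (y % n) / n * n  ≡⟨ cong (_+ a * (y % n) / n * n) aρ%n≡1 ⟩
    1 + a * (y % n) / n * n                ∎)
  where
  open ≡-Reasoning
  aρ+a[y/n]n≡ay : a * (y % n) + a * (y / n) * n ≡ a * y
  aρ+a[y/n]n≡ay = begin
    a * (y % n) + a * (y / n) * n  ≡⟨ cong (a * (y % n) +_) (*-assoc a (y / n) n) ⟩
    a * (y % n) + a * (y / n * n)  ≡⟨ *-distribˡ-+ a (y % n) (y / n * n) ⟨
    a * (y % n + y / n * n)        ≡⟨ cong (a *_) (m≡m%n+[m/n]*n y n) ⟨
    a * y                          ∎
  aρ%n≡1 : a * (y % n) % n ≡ 1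
  aρ%n≡1 = begin
    a * (y % n) % n                      ≡⟨ [m+kn]%n≡m%n (a * (y % n)) (a * (y / n)) n ⟨
    (a * (y % n) + a * (y / n) * n) % n  ≡⟨ %-congˡ aρ+a[y/n]n≡ay ⟩
    a * y % n                            ≡⟨ %-congˡ ay≡1+zn ⟩
    (1 + z * n) % n                      ≡⟨ [m+kn]%n≡m%n 1 z n ⟩
    1 % n                                ≡⟨ m<n⇒m%n≡m 1<n ⟩
    1                                    ∎

InSF-of-inverse : ∀ {Q a q} y z → a ≤ q → a * y ≡ 1 + z * q → q + a + y ⊓ q ≤ Q → InSF Q a q
InSF-of-inverse {a = zero} _ _ _ () _
InSF-of-inverse {a = suc zero} {q = suc zero} _ _ _ 1y≡1+z h≤Q =
  3 , inj₁ (refl , refl , refl) ,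
  ≤-trans (+-monoʳ-≤ 2 (⊓-glb (m*n≡1+k⇒0<n 1 1y≡1+z) ≤-refl)) h≤Q
InSF-of-inverse {a = suc (suc _)} {q = suc zero} _ _ (s≤s ()) _ _
InSF-of-inverse {a = a} {q = q@(suc (suc _))} y z _ ay≡1+zq h≤Q
  with k , aρ≡1+kq ← %-inverse {a} {y} {z} {q} (s≤s (s≤s z≤n)) ay≡1+zq =
  q + a + y % q ,
  inj₂ (s≤s (s≤s z≤n) , y % q , m*n≡1+k⇒0<n a aρ≡1+kq , m%n<n y q , (k , aρ≡1+kq) , refl) ,
  ≤-trans (+-monoʳ-≤ (q + a) (⊓-glb (m%n≤m y q) (m%n≤n y q))) h≤Q

-- With A ā = 1 + k X, the right Stern–Brocot parent of A/X is e/d = (A − k)/(X − ā),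
-- and ā is still an inverse of e modulo d.
right-parent : ∀ {Q A X} → InFarey Q A X → InSF Q A X → A < X →
               ∃₂ λ e d → e * X ≡ 1 + A * d × InFarey Q e d × InSF Q e d
right-parent _ (_ , inj₁ (refl , refl , _) , _) (s≤s ())
right-parent {A = A} {X} (_ , _ , X≤Q , _)
             (_ , inj₂ (_ , ā , _ , ā<X , (k , Aā≡1+kX) , refl) , h≤Q) A<X
  with m≤n⇒∃[o]m+o≡n k≤A | m≤n⇒∃[o]m+o≡n (<⇒≤ ā<X)
  where
  k≤A : k ≤ A
  k≤A = <⇒≤ (*-cancelʳ-< X k A
          (<-≤-trans (≤-reflexive (sym Aā≡1+kX)) (*-monoʳ-≤ A (<⇒≤ ā<X))))
... | e , refl | d , refl =
  e , d , eX≡1+Ad ,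
  (0<e , e≤d , ≤-trans (m≤n+m d ā) X≤Q , det≡1⇒coprime e (ā + d) (k + e) d eX≡1+Ad) ,
  InSF-of-inverse ā k e≤d eā≡1+kd
    (≤-trans (+-mono-≤ (+-mono-≤ (m≤n+m d ā) (m≤n+m e k)) (m⊓n≤m ā d)) h≤Q)
  where
  open ≡-Reasoning
  eā≡1+kd : e * ā ≡ 1 + k * d
  eā≡1+kd = +-cancelˡ-≡ (k * ā) _ _ (begin
    k * ā + e * ā        ≡⟨ *-distribʳ-+ ā k e ⟨
    (k + e) * ā          ≡⟨ Aā≡1+kX ⟩
    1 + k * (ā + d)      ≡⟨ cong suc (*-distribˡ-+ k ā d) ⟩
    1 + (k * ā + k * d)  ≡⟨ +-suc (k * ā) (k * d) ⟨
    k * ā + (1 + k * d)  ∎)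
  eX≡1+Ad : e * (ā + d) ≡ 1 + (k + e) * d
  eX≡1+Ad = begin
    e * (ā + d)          ≡⟨ *-distribˡ-+ e ā d ⟩
    e * ā + e * d        ≡⟨ cong (_+ e * d) eā≡1+kd ⟩
    1 + k * d + e * d    ≡⟨ cong suc (*-distribʳ-+ d k e) ⟨
    1 + (k + e) * d      ∎
  0<d : 0 < d
  0<d = +-cancelˡ-< ā 0 d (subst (_< ā + d) (sym (+-identityʳ ā)) ā<X)
  0<e : 0 < e
  0<e = m*n≡1+k⇒0<n ā (trans (*-comm ā e) eā≡1+kd)
  e≤d : e ≤ d
  e≤d = right-neighbour-≤1 eX≡1+Ad A<X 0<d

-- k y ≡ −1 modulo w + 1, hence y w is an inverse of k modulo w + 1.
negated-inverse : ∀ {b w} k y → 0 < b → 0 < w → b * suc w ≡ 1 + k * y →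
                  ∃ λ z → k * (y * w) ≡ 1 + z * suc w
negated-inverse {b@(suc b′)} {w@(suc w′)} k y _ _ b[1+w]≡1+ky = z , +-cancelʳ-≡ w _ _ (begin
    k * (y * w) + w    ≡⟨ e₁ k y w ⟩
    (1 + k * y) * w    ≡⟨ cong (_* w) b[1+w]≡1+ky ⟨
    b * suc w * w      ≡⟨ e₂ b (suc w) w ⟩
    suc z * suc w      ≡⟨ e₃ z w ⟩
    1 + z * suc w + w  ∎)
  where
  open ≡-Reasoning
  z : ℕ
  z = w′ + b′ * w
  e₁ : ∀ k y w → k * (y * w) + w ≡ (1 + k * y) * w
  e₁ = solve-∀
  e₂ : ∀ b u w → b * u * w ≡ b * w * u
  e₂ = solve-∀
  e₃ : ∀ z w → suc z * suc w ≡ 1 + z * suc w + w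
  e₃ = solve-∀

-- With B u = 1 + k Y, the left Stern–Brocot parent of B/Y is k/u; it is 0/1 when B = 1.
left-parent : ∀ {Q B Y} → InFarey Q B Y → InSF Q B Y → 2 ≤ B →
              ∃₂ λ k u → B * u ≡ 1 + k * Y × InFarey Q k u × InSF Q k u
left-parent _ (_ , inj₁ (refl , refl , _) , _) (s≤s ())
left-parent {Q} {B} {Y} (1≤B , B≤Y , Y≤Q , _)
            (_ , inj₂ (_ , u@(suc w) , _ , u<Y , (k , Bu≡1+kY) , refl) , h≤Q) 2≤B =
  k , u , Bu≡1+kY , (0<k , <⇒≤ k<u , ≤-trans (<⇒≤ u<Y) Y≤Q , k⊥u) ,
  InSF-of-inverse (Y * w) (proj₁ k-inverse) (<⇒≤ k<u) (proj₂ k-inverse)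
    (≤-trans (+-mono-≤ (+-monoʳ-≤ u k≤B) (m⊓n≤n (Y * w) u)) u+B+u≤Q)
  where
  open ≤-Reasoning
  0<k : 0 < k
  0<k = n≢0⇒n>0 λ { refl → <⇒≱ (≤-trans 2≤B (m≤m*n B u)) (≤-reflexive Bu≡1+kY) }
  k<u : k < u
  k<u = *-cancelʳ-< Y k u (begin-strict
    k * Y  <⟨ ≤-reflexive (sym Bu≡1+kY) ⟩
    B * u  ≤⟨ *-monoˡ-≤ u B≤Y ⟩
    Y * u  ≡⟨ *-comm Y u ⟩
    u * Y  ∎)
  k≤B : k ≤ B
  k≤B = <⇒≤ (*-cancelʳ-< Y k B
          (<-≤-trans (≤-reflexive (sym Bu≡1+kY)) (*-monoʳ-≤ B (<⇒≤ u<Y))))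
  k⊥u : Coprime k u
  k⊥u = coprime-sym (det≡1⇒coprime u B Y k
          (trans (*-comm u B) (trans Bu≡1+kY (cong suc (*-comm k Y)))))
  k-inverse : ∃ λ z → k * (Y * w) ≡ 1 + z * u
  k-inverse = negated-inverse k Y 1≤B (≤-trans 0<k (≤-pred k<u)) Bu≡1+kY
  u+B+u≤Q : u + B + u ≤ Q
  u+B+u≤Q = ≤-trans (+-monoˡ-≤ u (+-monoˡ-≤ B (<⇒≤ u<Y))) h≤Q

ConsecutiveChain : ℕ → ∀ {r} → (Fin (suc r) → ℕ) → (Fin (suc r) → ℕ) → Set
ConsecutiveChain Q {r} a q =
  ∀ (i : Fin r) → ConsecutiveIn Q (a (inject₁ i)) (q (inject₁ i)) (a (fsuc i)) (q (fsuc i))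

chain-increasing : ∀ {Q r} (a q : Fin (suc (suc r)) → ℕ) → ConsecutiveChain Q a q →
                   FracLt (a fzero) (q fzero) (a (fromℕ (suc r))) (q (fromℕ (suc r)))
chain-increasing {r = zero} _ _ chain = proj₁ (proj₂ (proj₂ (chain fzero)))
chain-increasing {r = suc r} a q chain =
  FracLt-trans (a fzero) (q fzero) (a (fsuc fzero)) (q (fsuc fzero)) (a last) (q last)
    (denominator>0 (proj₁ (chain fzero))) (denominator>0 (proj₁ (proj₂ (chain (fromℕ (suc r))))))
    (proj₁ (proj₂ (proj₂ (chain fzero)))) (chain-increasing (a ∘ fsuc) (q ∘ fsuc) (chain ∘ fsuc))
  where
  last : Fin (suc (suc (suc r)))
  last = fromℕ (suc (suc r))

chain-interior : ∀ {Q r} (a q : Fin (suc r) → ℕ) → ConsecutiveChain Q a q →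
                 ∀ {c t} → InFarey Q c t →
                 FracLt (a fzero) (q fzero) c t → FracLt c t (a (fromℕ r)) (q (fromℕ r)) →
                 ∃ λ (i : Fin r) → c ≡ a (fsuc i) × t ≡ q (fsuc i)
chain-interior {r = zero} _ _ _ _ a₀<c c<a₀ = ⊥-elim (<-asym a₀<c c<a₀)
chain-interior {r = suc r} a q chain F a₀<c c<aᵣ with chain fzero
... | _ , F₁ , _ , gap with FracLt-trichotomy F F₁
... | inj₁ c<a₁        = ⊥-elim (gap _ _ F (a₀<c , c<a₁))
... | inj₂ (inj₁ c≡a₁) = fzero , c≡a₁
... | inj₂ (inj₂ a₁<c) with chain-interior (a ∘ fsuc) (q ∘ fsuc) (chain ∘ fsuc) F a₁<c c<aᵣ
...   | i , c≡aᵢ = fsuc i , c≡aᵢ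

below-last⇒toℕ< : ∀ {r} (a q : Fin (suc r) → ℕ) (i : Fin (suc r)) →
                  FracLt (a i) (q i) (a (fromℕ r)) (q (fromℕ r)) → toℕ i < r
below-last⇒toℕ< {zero}  _ _ fzero    aᵣ<aᵣ = ⊥-elim (<-irrefl refl aᵣ<aᵣ)
below-last⇒toℕ< {suc r} _ _ fzero    _     = z<s
below-last⇒toℕ< {suc r} a q (fsuc i) aᵢ<aᵣ =
  s<s (below-last⇒toℕ< (a ∘ fsuc) (q ∘ fsuc) i aᵢ<aᵣ)

chain-interior-not-SF : ∀ {Q r} (a q : Fin (suc r) → ℕ) → ConsecutiveChain Q a q →
                        (∀ i → 0 < toℕ i → toℕ i < r → ¬ InSF Q (a i) (q i)) →
                        ∀ {c t} → InFarey Q c t → FracLt (a fzero) (q fzero) c t →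
                        FracLt c t (a (fromℕ r)) (q (fromℕ r)) → ¬ InSF Q c t
chain-interior-not-SF a q chain interior F a₀<c c<aᵣ with chain-interior a q chain F a₀<c c<aᵣ
... | i , refl , refl = interior (fsuc i) z<s (below-last⇒toℕ< a q (fsuc i) c<aᵣ)

record ConsecutiveInSF (Q A X B Y : ℕ) : Set where
  field
    left-farey    : InFarey Q A X
    right-farey   : InFarey Q B Y
    left-sf       : InSF Q A X
    right-sf      : InSF Q B Y
    increasing    : FracLt A X B Y
    no-sf-between : ∀ {c t} → InFarey Q c t → FracLt A X c t → FracLt c t B Y → ¬ InSF Q c t

module _ {Q A X B Y : ℕ} (consecutive : ConsecutiveInSF Q A X B Y) where
  open ConsecutiveInSF consecutive
  open ≤-Reasoning

  private
    neighbours-if-Y≤X : Y ≤ X → B * X ≡ 1 + A * Y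
    neighbours-if-Y≤X Y≤X with right-parent left-farey left-sf A<X
      where
      A<X : A < X
      A<X = *-cancelʳ-< Y A X (begin-strict
        A * Y  <⟨ increasing ⟩
        B * X  ≤⟨ *-monoˡ-≤ X (proj₁ (proj₂ right-farey)) ⟩
        Y * X  ≡⟨ *-comm Y X ⟩
        X * Y  ∎)
    ... | e , d , eX≡1+Ad , F , sf with FracLt-trichotomy F right-farey
    ... | inj₁ e/d<B/Y              = ⊥-elim (no-sf-between F (≤-reflexive (sym eX≡1+Ad)) e/d<B/Y sf)
    ... | inj₂ (inj₁ (refl , refl)) = eX≡1+Ad
    ... | inj₂ (inj₂ B/Y<e/d)       = ⊥-elim (<⇒≱ (m<m+n X (denominator>0 F)) (≤-trans
            (neighbours-squeeze A X B Y e d eX≡1+Ad increasing B/Y<e/d) Y≤X))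

    neighbours-if-X<Y : X < Y → B * X ≡ 1 + A * Y
    neighbours-if-X<Y X<Y with left-parent right-farey right-sf 2≤B
      where
      2≤B : 2 ≤ B
      2≤B = ≰⇒> λ B≤1 → <⇒≱ X<Y (<⇒≤ (begin-strict
        Y      ≤⟨ m≤n*m Y A {{>-nonZero (proj₁ left-farey)}} ⟩
        A * Y  <⟨ increasing ⟩
        B * X  ≤⟨ *-monoˡ-≤ X B≤1 ⟩
        1 * X  ≡⟨ *-identityˡ X ⟩
        X      ∎))
    ... | k , u , Bu≡1+kY , F , sf with FracLt-trichotomy left-farey F
    ... | inj₁ A/X<k/u              = ⊥-elim (no-sf-between F A/X<k/u (≤-reflexive (sym Bu≡1+kY)) sf)
    ... | inj₂ (inj₁ (refl , refl)) = Bu≡1+kY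
    ... | inj₂ (inj₂ k/u<A/X)       = ⊥-elim (<⇒≱ X<Y (≤-trans (m≤n+m Y u)
            (neighbours-squeeze k u A X B Y Bu≡1+kY k/u<A/X increasing)))

    A+B≤X+Y : A + B ≤ X + Y
    A+B≤X+Y = +-mono-≤ (proj₁ (proj₂ left-farey)) (proj₁ (proj₂ right-farey))

  consecutive⇒neighbours : B * X ≡ 1 + A * Y
  consecutive⇒neighbours with Y ≤? X
  ... | yes Y≤X = neighbours-if-Y≤X Y≤X
  ... | no  Y≰X = neighbours-if-X<Y (≰⇒> Y≰X)

  consecutive⇒Q≤3X+2Y : X + Y ≤ Q → Q ≤ 3 * X + 2 * Y
  consecutive⇒Q≤3X+2Y X+Y≤Q with X + Y + (A + B) + X ≤? Q
  ... | yes h≤Q = ⊥-elim (no-sf-between mediant-farey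
                    (≤-reflexive (sym left)) (≤-reflexive (sym right)) mediant-sf)
    where
    left : (A + B) * X ≡ 1 + A * (X + Y)
    left = proj₁ (mediant-neighbours A X B Y consecutive⇒neighbours)
    right : B * (X + Y) ≡ 1 + (A + B) * Y
    right = proj₂ (mediant-neighbours A X B Y consecutive⇒neighbours)
    mediant-farey : InFarey Q (A + B) (X + Y)
    mediant-farey = ≤-trans (proj₁ left-farey) (m≤m+n A B) , A+B≤X+Y , X+Y≤Q ,
                    det≡1⇒coprime (A + B) X A (X + Y) left
    mediant-sf : InSF Q (A + B) (X + Y)
    mediant-sf = InSF-of-inverse X A A+B≤X+Y left
                   (≤-trans (+-monoʳ-≤ (X + Y + (A + B)) (m⊓n≤m X (X + Y))) h≤Q)
  ... | no  h≰Q = begin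
    Q                    ≤⟨ <⇒≤ (≰⇒> h≰Q) ⟩
    X + Y + (A + B) + X  ≤⟨ +-monoˡ-≤ X (+-monoʳ-≤ (X + Y) A+B≤X+Y) ⟩
    X + Y + (X + Y) + X  ≡⟨ e X Y ⟩
    3 * X + 2 * Y        ∎
    where
    e : ∀ X Y → X + Y + (X + Y) + X ≡ 3 * X + 2 * Y
    e = solve-∀

inverse-complement : ∀ {X Y ā} A B k → A * ā ≡ 1 + k * X → B * X ≡ 1 + A * Y →
                     0 < ā → ā < X → Y < X → ā + Y ≡ X
inverse-complement {X} {Y} {ā} A B k Aā≡1+kX BX≡1+AY 0<ā ā<X Y<X
  with coprime-divisor (coprime-sym (det≡1⇒coprime A ā k X Aā≡1+kX))
                       (subst (X ∣_) (sym A[ā+Y]≡[k+B]X) (n∣m*n (k + B)))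
  where
  open ≡-Reasoning
  A[ā+Y]≡[k+B]X : A * (ā + Y) ≡ (k + B) * X
  A[ā+Y]≡[k+B]X = begin
    A * (ā + Y)          ≡⟨ *-distribˡ-+ A ā Y ⟩
    A * ā + A * Y        ≡⟨ cong (_+ A * Y) Aā≡1+kX ⟩
    1 + k * X + A * Y    ≡⟨ +-suc (k * X) (A * Y) ⟨
    k * X + (1 + A * Y)  ≡⟨ cong (k * X +_) BX≡1+AY ⟨
    k * X + B * X        ≡⟨ *-distribʳ-+ X k B ⟨
    (k + B) * X          ∎
... | divides zero ā+Y≡0 = ⊥-elim (<⇒≱ (≤-trans 0<ā (m≤m+n ā Y)) (≤-reflexive ā+Y≡0))
... | divides (suc zero) ā+Y≡1*X = trans ā+Y≡1*X (*-identityˡ X)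
... | divides (suc (suc c)) ā+Y≡[2+c]X = ⊥-elim (<⇒≱ (+-mono-< ā<X Y<X)
        (≤-trans (+-monoʳ-≤ X (m≤m+n X (c * X))) (≤-reflexive (sym ā+Y≡[2+c]X))))

right-neighbour⇒2X≤Q+Y : ∀ {Q A X Y} B → InSF Q A X → B * X ≡ 1 + A * Y → Y < X →
                         2 * X ≤ Q + Y
right-neighbour⇒2X≤Q+Y {Y = Y} _ (_ , inj₁ (_ , refl , refl) , 3≤Q) _ _ =
  ≤-trans (≤-trans (n≤1+n 2) 3≤Q) (m≤m+n _ Y)
right-neighbour⇒2X≤Q+Y {Q} {A} {X} {Y} B
  (_ , inj₂ (_ , ā , 0<ā , ā<X , (k , Aā≡1+kX) , refl) , h≤Q) BX≡1+AY Y<X = begin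
    2 * X          ≡⟨ cong (X +_) (+-identityʳ X) ⟩
    X + X          ≡⟨ cong (X +_) (inverse-complement A B k Aā≡1+kX BX≡1+AY 0<ā ā<X Y<X) ⟨
    X + (ā + Y)    ≡⟨ +-assoc X ā Y ⟨
    X + ā + Y      ≤⟨ +-monoˡ-≤ Y (+-monoˡ-≤ ā (m≤m+n X A)) ⟩
    X + A + ā + Y  ≤⟨ +-monoˡ-≤ Y h≤Q ⟩
    Q + Y          ∎
  where open ≤-Reasoning

inQV2⊎inQV3 : ∀ {Q X Y} → X + Y ≤ Q → Q ≤ 3 * X + 2 * Y → (Y < X → 2 * X ≤ Q + Y) →
              InQV2 Q X Y ⊎ InQV3 Q X Y
inQV2⊎inQV3 {Q} {X} {Y} X+Y≤Q Q≤3X+2Y Y<X⇒2X≤Q+Y with X ≤? Y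
... | yes X≤Y = inj₁ (2X≤Q , Q≤5Y , m+n≤o⇒n≤o X X+Y≤Q , Q≤3X+2Y , X≤Y , X+Y≤Q)
  where
  open ≤-Reasoning
  2X≤Q : 2 * X ≤ Q
  2X≤Q = begin
    2 * X        ≤⟨ +-monoʳ-≤ X (+-monoˡ-≤ 0 X≤Y) ⟩
    X + (Y + 0)  ≡⟨ cong (X +_) (+-identityʳ Y) ⟩
    X + Y        ≤⟨ X+Y≤Q ⟩
    Q            ∎
  Q≤5Y : Q ≤ 5 * Y
  Q≤5Y = begin
    Q              ≤⟨ Q≤3X+2Y ⟩
    3 * X + 2 * Y  ≤⟨ +-monoˡ-≤ (2 * Y) (*-monoʳ-≤ 3 X≤Y) ⟩
    3 * Y + 2 * Y  ≡⟨ *-distribʳ-+ Y 3 2 ⟨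
    5 * Y          ∎
... | no X≰Y = inj₂ (Q≤5X , 3X≤2Q , 2Y≤Q , Q≤3X+2Y , Y<X⇒2X≤Q+Y Y<X , <⇒≤ Y<X , X+Y≤Q)
  where
  open ≤-Reasoning
  Y<X : Y < X
  Y<X = ≰⇒> X≰Y
  Q≤5X : Q ≤ 5 * X
  Q≤5X = begin
    Q              ≤⟨ Q≤3X+2Y ⟩
    3 * X + 2 * Y  ≤⟨ +-monoʳ-≤ (3 * X) (*-monoʳ-≤ 2 (<⇒≤ Y<X)) ⟩
    3 * X + 2 * X  ≡⟨ *-distribʳ-+ X 3 2 ⟨
    5 * X          ∎
  3X≤2Q : 3 * X ≤ 2 * Q
  3X≤2Q = +-cancelʳ-≤ Y (3 * X) (2 * Q) (begin
    3 * X + Y        ≡⟨ e₁ X Y ⟩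
    2 * X + (X + Y)  ≤⟨ +-mono-≤ (Y<X⇒2X≤Q+Y Y<X) X+Y≤Q ⟩
    Q + Y + Q        ≡⟨ e₂ Q Y ⟩
    2 * Q + Y        ∎)
    where
    e₁ : ∀ X Y → 3 * X + Y ≡ 2 * X + (X + Y)
    e₁ = solve-∀
    e₂ : ∀ Q Y → Q + Y + Q ≡ 2 * Q + Y
    e₂ = solve-∀
  2Y≤Q : 2 * Y ≤ Q
  2Y≤Q = begin
    2 * Y        ≤⟨ +-monoʳ-≤ Y (+-monoˡ-≤ 0 (<⇒≤ Y<X)) ⟩
    Y + (X + 0)  ≡⟨ cong (Y +_) (+-identityʳ X) ⟩
    Y + X        ≡⟨ +-comm Y X ⟩
    X + Y        ≤⟨ X+Y≤Q ⟩
    Q            ∎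

proposition8 : (Q r : ℕ) → 3 ≤ Q → 2 ≤ r →
    ∀ x y → InD Q r x y → InQV2 Q x y ⊎ InQV3 Q x y
proposition8 Q zero          _ ()
proposition8 Q (suc zero)    _ (s≤s ())
proposition8 Q (suc (suc r)) _ _ _ _ (a , q , chain , sf₀ , sfᵣ , interior , refl , refl) =
  inQV2⊎inQV3 X+Y≤Q (consecutive⇒Q≤3X+2Y consecutive X+Y≤Q)
    (right-neighbour⇒2X≤Q+Y (a last) sf₀ (consecutive⇒neighbours consecutive))
  where
  last : Fin (suc (suc (suc r)))
  last = fromℕ (suc (suc r))
  consecutive : ConsecutiveInSF Q (a fzero) (q fzero) (a last) (q last)
  consecutive = record
    { left-farey    = proj₁ (chain fzero)
    ; right-farey   = proj₁ (proj₂ (chain (fromℕ (suc r))))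
    ; left-sf       = sf₀
    ; right-sf      = sfᵣ
    ; increasing    = chain-increasing a q chain
    ; no-sf-between = chain-interior-not-SF a q chain interior
    }
  X+Y≤Q : q fzero + q last ≤ Q
  X+Y≤Q with _ , (_ , _ , q₁≤Q , _) , a₀<a₁ , _ ← chain fzero =
    ≤-trans (neighbours-squeeze (a fzero) (q fzero) (a (fsuc fzero)) (q (fsuc fzero)) (a last) (q last)
               (consecutive⇒neighbours consecutive) a₀<a₁
               (chain-increasing (a ∘ fsuc) (q ∘ fsuc) (chain ∘ fsuc)))
            q₁≤Q
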